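{- Let $G = C_m^{u_1,\dots,u_k}(T_1,\dots,T_k)$ be a unicyclic graph of order $n$ with $k\ge1$ and $n(T_i)=l_i+1$ for $i=1,\dots,k$. Then $$HM(G)\le HM(C_m^{u_1,\dots,u_k}(l_1,\dots,l_k)) \le HM(C_m(n-m)),$$ with equality on the left if and only if, for each $i$, $T_i$ is a star $S_{l_i+1}$ with center $u_i$, and equality on the right if and only if $k=1$.
   Context: A unicyclic graph is a connected graph with exactly one cycle. For a unicyclic graph $G$ with cycle $C_m$, $G=C_m^{u_1,\dots,u_k}(T_1,\dots,T_k)$ means that $T_1,\dots,T_k$ are all the non-trivial components of $G-E(C_m)$ (trees) and $u_i$ is the common vertex of $T_i$ and $C_m$; $n(T_i)$ is the number of vertices of $T_i$. $C_m^{u_1,\dots,u_k}(l_1,\dots,l_k)$ is the graph obtained from $C_m$ by attaching $l_i$ pendant vertices to $u_i$ for each $i$ (i.e. replacing $T_i$ by a star centered at $u_i$). $C_m(n-m)$ is $C_m$ with $n-m$ pendant vertices attached to one cycle vertex. $HM(G)=\sum_{xy\in E(G)}(d_G(x)+d_G(y))^2$. -}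

module Defs where

open import Data.Nat using (ℕ; zero; suc; _+_; _*_; _∸_; _^_; _≡ᵇ_; _<ᵇ_)
open import Data.Bool using (Bool; true; false; if_then_else_)
open import Data.Product using (_×_; _,_)
open import Data.Nat.ListAction using (sum)
open import Data.List using (List; []; _∷_; _++_; map; upTo; replicate; length; filter)
open import Data.Vec as Vec using (Vec; toList)
open import Data.List.Relation.Unary.All using (All)
open import Relation.Binary.PropositionalEquality using (_≡_)

data Tree : Set where
  node : List Tree → Tree

leaf : Tree
leaf = node []

-- number of NON-ROOT vertices of a rooted tree (so n(T) = nonroot T + 1)
nonroot  : Tree → ℕ
nonroots : List Tree → ℕ
nonroot (node cs) = nonroots cs
nonroots [] = 0
nonroots (c ∷ cs) = suc (nonroot c) + nonroots cs

star : ℕ → Tree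
star l = node (replicate l leaf)

CenteredStar : Tree → Set
CenteredStar (node cs) = All (λ c → c ≡ leaf) cs

Edge : Set
Edge = ℕ × ℕ

inc : ℕ → Edge → ℕ
inc v (a , b) = (if a ≡ᵇ v then 1 else 0) + (if b ≡ᵇ v then 1 else 0)

deg : List Edge → ℕ → ℕ
deg E v = sum (map (inc v) E)

HM : List Edge → ℕ
HM E = sum (map (λ { (a , b) → (deg E a + deg E b) ^ 2 }) E)

-- Edges of a rooted tree whose root has label r; the non-root vertices
-- receive the fresh labels f, f+1, …, f + nonroot T ∸ 1.

treeEdges     : ℕ → ℕ → Tree → List Edge
childrenEdges : ℕ → ℕ → List Tree → List Edge
treeEdges r f (node cs) = childrenEdges r f cs
childrenEdges r f [] = []
childrenEdges r f (c ∷ cs) =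
  (r , f) ∷ (treeEdges f (suc f) c ++ childrenEdges r (suc f + nonroot c) cs)

cycleEdges : ℕ → List Edge
cycleEdges m = map (λ i → (i , suc i)) (upTo (m ∸ 1)) ++ ((m ∸ 1 , 0) ∷ [])

attach : ℕ → ℕ → List Tree → List Edge
attach i f [] = []
attach i f (t ∷ ts) = treeEdges i f t ++ attach (suc i) (f + nonroot t) ts

-- The unicyclic graph C_m with tree ts[i] attached at cycle vertex i
-- (trivial trees = nothing attached).
unicyclic : (m : ℕ) → Vec Tree m → List Edge
unicyclic m ts = cycleEdges m ++ attach 0 m (toList ts)

order : (m : ℕ) → Vec Tree m → ℕ
order m ts = m + sum (map nonroot (toList ts))

-- k = number of non-trivial attached trees
isNontrivial : Tree → Bool
isNontrivial t = 0 <ᵇ nonroot t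

numNontrivial : {m : ℕ} → Vec Tree m → ℕ
numNontrivial ts = length (filter (λ t → Data.Bool.T? (isNontrivial t)) (toList ts))
  where import Data.Bool

-- C_m^{u_1..u_k}(l_1..l_k): replace each attached tree T_i by the star S_{l_i+1}
starify : {m : ℕ} → Vec Tree m → Vec Tree m
starify = Vec.map (λ t → star (nonroot t))

-- C_m(p): p pendant vertices attached at the single cycle vertex 0
pendantsAt0 : (m p : ℕ) → Vec Tree m
pendantsAt0 zero p = Vec.[]
pendantsAt0 (suc m) p = star p Vec.∷ Vec.replicate m leaf

-- Split HM into the cycle edges and the tree edges.  A cycle vertex u_i has degree 2 + (root degree of T_i),
-- and an edge of a tree T_i with l_i non-root vertices has degree sum at most l_i + 3, so the edges of T_i
-- contribute at most l_i (l_i + 3)², with equality only for the star centred at u_i; replacing T_i by that star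
-- can only raise the cycle degrees.  In the starified graph write x_i = l_i and L = Σ x_i: a cycle edge ab
-- contributes (4 + s)² ≤ 16 + (8 + L) s with s = x_a + x_b ≤ L, the s sum to 2L, and the star terms satisfy
-- Σ x_i (x_i + 3)² ≤ L (L + 3)², strictly as soon as two x_i are positive.  C_m(n − m) attains every bound.

module Submission where

open import Defs
open import Data.Bool using (if_then_else_; T?)
open import Data.Empty using (⊥-elim)
open import Data.List using (List; []; _∷_; [_]; _++_; map; upTo; length; filter; replicate)
open import Data.List.Relation.Unary.All as LAll using ()
open import Data.List.Properties using (map-++; map-∘; map-cong; upTo-∷ʳ; length-replicate)
open import Data.Nat using (ℕ; zero; suc; _+_; _*_; _∸_; _^_; _≤_; _<_; z≤n; s≤s; z<s; _≡ᵇ_)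
open import Data.Nat.ListAction using (sum)
open import Data.Nat.ListAction.Properties using (sum-++)
open import Data.Nat.Properties
open import Data.Nat.Tactic.RingSolver using (solve-∀)
open import Algebra.Properties.CommutativeSemigroup +-commutativeSemigroup using (interchange)
open import Data.Product using (_×_; _,_; proj₂)
open import Data.Sum using (_⊎_; inj₁; inj₂)
open import Data.Vec as Vec using (Vec; toList)
open import Data.Vec.Properties using (length-toList)
open import Data.Vec.Relation.Unary.All as VAll using (All)
open import Function using (_∘_)
open import Function.Bundles using (_⇔_; mk⇔)
open import Relation.Binary.PropositionalEquality hiding ([_])
open import Relation.Nullary using (¬_)

open ≤-Reasoning

sumBelow : ℕ → (ℕ → ℕ) → ℕ
sumBelow zero    f = 0
sumBelow (suc n) f = sumBelow n f + f n

sum-map-upTo : ∀ n (f : ℕ → ℕ) → sum (map f (upTo n)) ≡ sumBelow n f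
sum-map-upTo zero    f = refl
sum-map-upTo (suc n) f = begin-equality
  sum (map f (upTo (suc n)))      ≡⟨ cong (sum ∘ map f) (sym (upTo-∷ʳ n)) ⟩
  sum (map f (upTo n ++ [ n ]))   ≡⟨ cong sum (map-++ f (upTo n) [ n ]) ⟩
  sum (map f (upTo n) ++ [ f n ]) ≡⟨ sum-++ (map f (upTo n)) [ f n ] ⟩
  sum (map f (upTo n)) + (f n + 0) ≡⟨ cong₂ _+_ (sum-map-upTo n f) (+-identityʳ (f n)) ⟩
  sumBelow n f + f n              ∎

sumBelow-suc : ∀ n (f : ℕ → ℕ) → sumBelow (suc n) f ≡ f 0 + sumBelow n (f ∘ suc)
sumBelow-suc zero    f = +-comm 0 (f 0)
sumBelow-suc (suc n) f = trans (cong (_+ f (suc n)) (sumBelow-suc n f)) (+-assoc (f 0) _ _)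

sumBelow-cong : ∀ n {f g : ℕ → ℕ} → (∀ i → i < n → f i ≡ g i) → sumBelow n f ≡ sumBelow n g
sumBelow-cong zero    f≡g = refl
sumBelow-cong (suc n) f≡g = cong₂ _+_ (sumBelow-cong n (λ i i<n → f≡g i (m<n⇒m<1+n i<n))) (f≡g n ≤-refl)

sumBelow-mono : ∀ n {f g : ℕ → ℕ} → (∀ i → i < n → f i ≤ g i) → sumBelow n f ≤ sumBelow n g
sumBelow-mono zero    f≤g = z≤n
sumBelow-mono (suc n) f≤g = +-mono-≤ (sumBelow-mono n (λ i i<n → f≤g i (m<n⇒m<1+n i<n))) (f≤g n ≤-refl)

sumBelow-+ : ∀ n (f g : ℕ → ℕ) → sumBelow n (λ i → f i + g i) ≡ sumBelow n f + sumBelow n g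
sumBelow-+ zero    f g = refl
sumBelow-+ (suc n) f g = begin-equality
  sumBelow n (λ i → f i + g i) + (f n + g n)   ≡⟨ cong (_+ (f n + g n)) (sumBelow-+ n f g) ⟩
  sumBelow n f + sumBelow n g + (f n + g n)    ≡⟨ interchange (sumBelow n f) (sumBelow n g) (f n) (g n) ⟩
  sumBelow n f + f n + (sumBelow n g + g n)    ∎

sumBelow-affine : ∀ n c k (f : ℕ → ℕ) → sumBelow n (λ i → c + k * f i) ≡ n * c + k * sumBelow n f
sumBelow-affine zero    c k f = sym (*-zeroʳ k)
sumBelow-affine (suc n) c k f = begin-equality
  sumBelow n (λ i → c + k * f i) + (c + k * f n)  ≡⟨ cong (_+ (c + k * f n)) (sumBelow-affine n c k f) ⟩
  n * c + k * sumBelow n f + (c + k * f n)        ≡⟨ regroup n c k (sumBelow n f) (f n) ⟩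
  suc n * c + k * (sumBelow n f + f n)            ∎
  where
  regroup : ∀ n c k s x → n * c + k * s + (c + k * x) ≡ suc n * c + k * (s + x)
  regroup = solve-∀

+-≤-tight : ∀ {a a' b b'} → a ≤ a' → b ≤ b' → a + b ≡ a' + b' → a ≡ a' × b ≡ b'
+-≤-tight {a} {a'} {b} {b'} a≤a' b≤b' eq = ≤-antisym a≤a' a'≤a , ≤-antisym b≤b' b'≤b
  where
  a'≤a : a' ≤ a
  a'≤a = +-cancelʳ-≤ b' a' a (subst (_≤ a + b') eq (+-monoʳ-≤ a b≤b'))
  b'≤b : b' ≤ b
  b'≤b = +-cancelˡ-≤ a' b' b (subst (_≤ a' + b) eq (+-monoˡ-≤ b a≤a'))

indicator : ℕ → ℕ → ℕ
indicator v i = if i ≡ᵇ v then 1 else 0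

indicator-self : ∀ v → indicator v v ≡ 1
indicator-self zero    = refl
indicator-self (suc v) = indicator-self v

indicator-other : ∀ {v i} → i ≢ v → indicator v i ≡ 0
indicator-other {zero}  {zero}  i≢v = ⊥-elim (i≢v refl)
indicator-other {zero}  {suc i} i≢v = refl
indicator-other {suc v} {zero}  i≢v = refl
indicator-other {suc v} {suc i} i≢v = indicator-other (i≢v ∘ cong suc)

sumBelow-indicator-≥ : ∀ n v → n ≤ v → sumBelow n (indicator v) ≡ 0
sumBelow-indicator-≥ zero    v n≤v = refl
sumBelow-indicator-≥ (suc n) v n<v =
  cong₂ _+_ (sumBelow-indicator-≥ n v (<⇒≤ n<v)) (indicator-other (<⇒≢ n<v))

sumBelow-indicator-< : ∀ n v → v < n → sumBelow n (indicator v) ≡ 1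
sumBelow-indicator-< (suc n) v (s≤s v≤n) with m≤n⇒m<n∨m≡n v≤n
... | inj₁ v<n  = cong₂ _+_ (sumBelow-indicator-< n v v<n) (indicator-other (>⇒≢ v<n))
... | inj₂ refl = cong₂ _+_ (sumBelow-indicator-≥ v v ≤-refl) (indicator-self v)

inc-other : ∀ {v a b} → a ≢ v → b ≢ v → inc v (a , b) ≡ 0
inc-other a≢v b≢v = cong₂ _+_ (indicator-other a≢v) (indicator-other b≢v)

weight : (ℕ → ℕ) → Edge → ℕ
weight δ (a , b) = (δ a + δ b) ^ 2

weightSum : (ℕ → ℕ) → List Edge → ℕ
weightSum δ E = sum (map (weight δ) E)

HM≡weightSum : ∀ E → HM E ≡ weightSum (deg E) E
HM≡weightSum E = cong sum (map-cong (λ { (a , b) → refl }) E)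

sum-map-++ : ∀ (f : Edge → ℕ) E F → sum (map f (E ++ F)) ≡ sum (map f E) + sum (map f F)
sum-map-++ f E F = trans (cong sum (map-++ f E F)) (sum-++ (map f E) (map f F))

weightSum-++ : ∀ δ E F → weightSum δ (E ++ F) ≡ weightSum δ E + weightSum δ F
weightSum-++ δ = sum-map-++ (weight δ)

deg-++ : ∀ E F v → deg (E ++ F) v ≡ deg E v + deg F v
deg-++ E F v = sum-map-++ (inc v) E F

-- The fresh labels f, …, f + n − 1 given by treeEdges r f to the non-root vertices of a tree.
InRange : ℕ → ℕ → ℕ → Set
InRange f n v = f ≤ v × v < f + n

inRange-+ˡ : ∀ {f a b v} → InRange f a v → InRange f (a + b) v
inRange-+ˡ {f} {a} {b} (f≤v , v<f+a) = f≤v , <-≤-trans v<f+a (+-monoʳ-≤ f (m≤m+n a b))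

inRange-+ʳ : ∀ {f a b v} → InRange (f + a) b v → InRange f (a + b) v
inRange-+ʳ {f} {a} {b} {v} (f+a≤v , v<f+a+b) =
  ≤-trans (m≤m+n f a) f+a≤v , subst (v <_) (+-assoc f a b) v<f+a+b

inRange-suc : ∀ {f n v} → InRange (suc f) n v → InRange f (suc n) v
inRange-suc {f} {n} {v} (f<v , v<) = <⇒≤ f<v , subst (v <_) (sym (+-suc f n)) v<

inRange-start : ∀ f n → InRange f (suc n) f
inRange-start f n = ≤-refl , subst (f <_) (sym (+-suc f n)) (s≤s (m≤m+n f n))

<⇒∉InRange : ∀ {f n v} → v < f → ¬ InRange f n v
<⇒∉InRange v<f (f≤v , _) = <⇒≱ v<f f≤v

≥⇒∉InRange : ∀ {f n v} → f + n ≤ v → ¬ InRange f n v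
≥⇒∉InRange f+n≤v (_ , v<f+n) = <⇒≱ v<f+n f+n≤v

rootDegree : Tree → ℕ
rootDegree (node cs) = length cs

-- treeHM e t: the edges' share of HM for a rooted tree t whose root has e neighbours outside t;
-- forestHM d cs: the same for the subtrees cs hanging from a root of degree d.
treeHM   : ℕ → Tree → ℕ
forestHM : ℕ → List Tree → ℕ
treeHM e (node cs) = forestHM (length cs + e) cs
forestHM d []       = 0
forestHM d (c ∷ cs) = (d + suc (rootDegree c)) ^ 2 + treeHM 1 c + forestHM d cs

deg-childrenEdges-∷ : ∀ c cs r f v →
  deg (childrenEdges r f (c ∷ cs)) v
    ≡ inc v (r , f) + (deg (treeEdges f (suc f) c) v + deg (childrenEdges r (suc f + nonroot c) cs) v)
deg-childrenEdges-∷ c cs r f v =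
  cong (inc v (r , f) +_) (deg-++ (treeEdges f (suc f) c) (childrenEdges r (suc f + nonroot c) cs) v)

deg-treeEdges-outside     : ∀ t {r f v} → r ≢ v → ¬ InRange f (nonroot t) v →
  deg (treeEdges r f t) v ≡ 0
deg-childrenEdges-outside : ∀ cs {r f v} → r ≢ v → ¬ InRange f (nonroots cs) v →
  deg (childrenEdges r f cs) v ≡ 0
deg-treeEdges-outside (node cs) = deg-childrenEdges-outside cs
deg-childrenEdges-outside []                 r≢v v∉ = refl
deg-childrenEdges-outside (c ∷ cs) {r} {f} {v} r≢v v∉ =
  trans (deg-childrenEdges-∷ c cs r f v)
        (cong₂ _+_ (inc-other r≢v f≢v)
                   (cong₂ _+_ (deg-treeEdges-outside c f≢v (v∉ ∘ inRange-suc ∘ inRange-+ˡ))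
                              (deg-childrenEdges-outside cs r≢v (v∉ ∘ inRange-suc ∘ inRange-+ʳ))))
  where
  f≢v : f ≢ v
  f≢v refl = v∉ (inRange-start f _)

deg-childrenEdges-root : ∀ cs {r f} → r < f → deg (childrenEdges r f cs) r ≡ length cs
deg-childrenEdges-root []                 r<f = refl
deg-childrenEdges-root (c ∷ cs) {r} {f} r<f =
  trans (deg-childrenEdges-∷ c cs r f r)
        (cong₂ _+_ (cong₂ _+_ (indicator-self r) (indicator-other (>⇒≢ r<f)))
                   (cong₂ _+_ (deg-treeEdges-outside c (>⇒≢ r<f) (<⇒∉InRange (m<n⇒m<1+n r<f)))
                              (deg-childrenEdges-root cs (<-trans r<f (s≤s (m≤m+n f (nonroot c)))))))

deg-treeEdges-root : ∀ t {r f} → r < f → deg (treeEdges r f t) r ≡ rootDegree t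
deg-treeEdges-root (node cs) = deg-childrenEdges-root cs

deg-childrenEdges-child : ∀ c cs {r f} → r < f → deg (childrenEdges r f (c ∷ cs)) f ≡ suc (rootDegree c)
deg-childrenEdges-child c cs {r} {f} r<f =
  trans (deg-childrenEdges-∷ c cs r f f)
        (cong₂ _+_ (cong₂ _+_ (indicator-other (<⇒≢ r<f)) (indicator-self f))
                   (trans (cong₂ _+_ (deg-treeEdges-root c (n<1+n f))
                                     (deg-childrenEdges-outside cs (<⇒≢ r<f) (<⇒∉InRange f<f')))
                          (+-identityʳ _)))
  where
  f<f' : f < suc f + nonroot c
  f<f' = s≤s (m≤m+n f (nonroot c))

deg-childrenEdges-subtree : ∀ c cs {r f v} → r < f → InRange (suc f) (nonroot c) v →
  deg (childrenEdges r f (c ∷ cs)) v ≡ deg (treeEdges f (suc f) c) v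
deg-childrenEdges-subtree c cs {r} {f} {v} r<f (f<v , v<f') =
  trans (deg-childrenEdges-∷ c cs r f v)
        (trans (cong₂ _+_ (inc-other r≢v (<⇒≢ f<v))
                          (cong (deg (treeEdges f (suc f) c) v +_)
                                (deg-childrenEdges-outside cs r≢v (<⇒∉InRange v<f'))))
               (+-identityʳ _))
  where
  r≢v : r ≢ v
  r≢v = <⇒≢ (<-trans r<f f<v)

deg-childrenEdges-rest : ∀ c cs {r f v} → r < f → InRange (suc f + nonroot c) (nonroots cs) v →
  deg (childrenEdges r f (c ∷ cs)) v ≡ deg (childrenEdges r (suc f + nonroot c) cs) v
deg-childrenEdges-rest c cs {r} {f} {v} r<f (f'≤v , _) =
  trans (deg-childrenEdges-∷ c cs r f v)
        (cong₂ _+_ (inc-other (<⇒≢ (<-trans r<f f<v)) (<⇒≢ f<v))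
                   (cong (_+ deg (childrenEdges r (suc f + nonroot c) cs) v)
                         (deg-treeEdges-outside c (<⇒≢ f<v) (≥⇒∉InRange f'≤v))))
  where
  f<v : f < v
  f<v = <-≤-trans (s≤s (m≤m+n f (nonroot c))) f'≤v

weightSum-treeEdges : ∀ t {r f} (δ : ℕ → ℕ) e → r < f → δ r ≡ rootDegree t + e →
  (∀ v → InRange f (nonroot t) v → δ v ≡ deg (treeEdges r f t) v) →
  weightSum δ (treeEdges r f t) ≡ treeHM e t
weightSum-childrenEdges : ∀ cs {r f} (δ : ℕ → ℕ) d → r < f → δ r ≡ d →
  (∀ v → InRange f (nonroots cs) v → δ v ≡ deg (childrenEdges r f cs) v) →
  weightSum δ (childrenEdges r f cs) ≡ forestHM d cs
weightSum-treeEdges (node cs) δ e = weightSum-childrenEdges cs δ (length cs + e)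
weightSum-childrenEdges []       δ d r<f δr agree = refl
weightSum-childrenEdges (c ∷ cs) {r} {f} δ d r<f δr agree = begin-equality
  (δ r + δ f) ^ 2 + weightSum δ (Tc ++ Cc)
    ≡⟨ cong₂ _+_ (cong₂ (λ a b → (a + b) ^ 2) δr δf) (weightSum-++ δ Tc Cc) ⟩
  rootEdge + (weightSum δ Tc + weightSum δ Cc)
    ≡⟨ cong (rootEdge +_) (cong₂ _+_ (weightSum-treeEdges c δ 1 (n<1+n f) (trans δf (+-comm 1 _)) agreeT)
                                       (weightSum-childrenEdges cs δ d (<-trans r<f f<f') δr agreeC)) ⟩
  rootEdge + (treeHM 1 c + forestHM d cs)
    ≡⟨ sym (+-assoc rootEdge (treeHM 1 c) (forestHM d cs)) ⟩
  rootEdge + treeHM 1 c + forestHM d cs ∎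
  where
  f' = suc f + nonroot c
  Tc = treeEdges f (suc f) c
  Cc = childrenEdges r f' cs
  rootEdge = (d + suc (rootDegree c)) ^ 2
  f<f' : f < f'
  f<f' = s≤s (m≤m+n f (nonroot c))
  δf : δ f ≡ suc (rootDegree c)
  δf = trans (agree f (inRange-start f _)) (deg-childrenEdges-child c cs r<f)
  agreeT : ∀ v → InRange (suc f) (nonroot c) v → δ v ≡ deg Tc v
  agreeT v v∈ = trans (agree v (inRange-suc (inRange-+ˡ v∈))) (deg-childrenEdges-subtree c cs r<f v∈)
  agreeC : ∀ v → InRange f' (nonroots cs) v → δ v ≡ deg Cc v
  agreeC v v∈ = trans (agree v (inRange-suc (inRange-+ʳ v∈))) (deg-childrenEdges-rest c cs r<f v∈)

treeAt : List Tree → ℕ → Tree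
treeAt []       _       = leaf
treeAt (t ∷ ts) zero    = t
treeAt (t ∷ ts) (suc i) = treeAt ts i

treesSize : List Tree → ℕ
treesSize ts = sum (map nonroot ts)

deg-attach-outside : ∀ ts {i f v} → ¬ InRange i (length ts) v → ¬ InRange f (treesSize ts) v →
  deg (attach i f ts) v ≡ 0
deg-attach-outside []                     v∉roots v∉fresh = refl
deg-attach-outside (t ∷ ts) {i} {f} {v} v∉roots v∉fresh =
  trans (deg-++ (treeEdges i f t) (attach (suc i) (f + nonroot t) ts) v)
        (cong₂ _+_ (deg-treeEdges-outside t i≢v (v∉fresh ∘ inRange-+ˡ))
                   (deg-attach-outside ts (v∉roots ∘ inRange-suc) (v∉fresh ∘ inRange-+ʳ)))
  where
  i≢v : i ≢ v
  i≢v refl = v∉roots (inRange-start i (length ts))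

deg-attach-root : ∀ ts {i f} j → i + length ts ≤ f → j < length ts →
  deg (attach i f ts) (i + j) ≡ rootDegree (treeAt ts j)
deg-attach-root (t ∷ ts) {i} {f} zero i+l≤f _ rewrite +-identityʳ i =
  trans (deg-++ (treeEdges i f t) (attach (suc i) (f + nonroot t) ts) i)
        (trans (cong₂ _+_ (deg-treeEdges-root t i<f)
                          (deg-attach-outside ts (<⇒∉InRange (n<1+n i))
                                                 (<⇒∉InRange (≤-trans i<f (m≤m+n f (nonroot t))))))
               (+-identityʳ _))
  where
  i<f : i < f
  i<f = <-≤-trans (m<m+n i z<s) i+l≤f
deg-attach-root (t ∷ ts) {i} {f} (suc j) i+l≤f (s≤s j<l) =
  trans (deg-++ (treeEdges i f t) (attach (suc i) (f + nonroot t) ts) (i + suc j))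
        (cong₂ _+_ (deg-treeEdges-outside t (<⇒≢ (m<m+n i z<s)) (<⇒∉InRange v<f))
                   (trans (cong (deg (attach (suc i) (f + nonroot t) ts)) (+-suc i j))
                          (deg-attach-root ts j (≤-trans si+l≤f (m≤m+n f (nonroot t))) j<l)))
  where
  si+l≤f : suc i + length ts ≤ f
  si+l≤f = subst (_≤ f) (+-suc i (length ts)) i+l≤f
  v<f : i + suc j < f
  v<f = subst (_< f) (sym (+-suc i j)) (<-≤-trans (s≤s (+-monoʳ-< i j<l)) si+l≤f)

deg-attach-first : ∀ t ts {i f v} → i + length (t ∷ ts) ≤ f → InRange f (nonroot t) v →
  deg (attach i f (t ∷ ts)) v ≡ deg (treeEdges i f t) v
deg-attach-first t ts {i} {f} {v} i+l≤f (f≤v , v<f') =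
  trans (deg-++ (treeEdges i f t) (attach (suc i) (f + nonroot t) ts) v)
        (trans (cong (deg (treeEdges i f t) v +_) (deg-attach-outside ts roots∌v (<⇒∉InRange v<f')))
               (+-identityʳ _))
  where
  roots∌v : ¬ InRange (suc i) (length ts) v
  roots∌v = ≥⇒∉InRange (≤-trans (subst (_≤ f) (+-suc i (length ts)) i+l≤f) f≤v)

deg-attach-rest : ∀ t ts {i f v} → i + length (t ∷ ts) ≤ f → InRange (f + nonroot t) (treesSize ts) v →
  deg (attach i f (t ∷ ts)) v ≡ deg (attach (suc i) (f + nonroot t) ts) v
deg-attach-rest t ts {i} {f} {v} i+l≤f (f'≤v , _) =
  trans (deg-++ (treeEdges i f t) (attach (suc i) (f + nonroot t) ts) v)
        (cong (_+ deg (attach (suc i) (f + nonroot t) ts) v)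
              (deg-treeEdges-outside t (<⇒≢ i<v) (≥⇒∉InRange f'≤v)))
  where
  i<v : i < v
  i<v = <-≤-trans (m<m+n i z<s) (≤-trans i+l≤f (≤-trans (m≤m+n f (nonroot t)) f'≤v))

weightSum-attach : ∀ ts {i f} (δ : ℕ → ℕ) → i + length ts ≤ f →
  (∀ j → j < length ts → δ (i + j) ≡ rootDegree (treeAt ts j) + 2) →
  (∀ v → InRange f (treesSize ts) v → δ v ≡ deg (attach i f ts) v) →
  weightSum δ (attach i f ts) ≡ sum (map (treeHM 2) ts)
weightSum-attach []       δ i+l≤f roots agree = refl
weightSum-attach (t ∷ ts) {i} {f} δ i+l≤f roots agree =
  trans (weightSum-++ δ (treeEdges i f t) (attach (suc i) (f + nonroot t) ts))
        (cong₂ _+_ (weightSum-treeEdges t δ 2 (<-≤-trans (m<m+n i z<s) i+l≤f) δi agreeFirst)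
                   (weightSum-attach ts δ (≤-trans si+l≤f (m≤m+n f (nonroot t))) roots′ agreeRest))
  where
  si+l≤f : suc i + length ts ≤ f
  si+l≤f = subst (_≤ f) (+-suc i (length ts)) i+l≤f
  δi : δ i ≡ rootDegree t + 2
  δi = trans (cong δ (sym (+-identityʳ i))) (roots 0 z<s)
  roots′ : ∀ j → j < length ts → δ (suc i + j) ≡ rootDegree (treeAt ts j) + 2
  roots′ j j<l = trans (cong δ (sym (+-suc i j))) (roots (suc j) (s≤s j<l))
  agreeFirst : ∀ v → InRange f (nonroot t) v → δ v ≡ deg (treeEdges i f t) v
  agreeFirst v v∈ = trans (agree v (inRange-+ˡ v∈)) (deg-attach-first t ts i+l≤f v∈)
  agreeRest : ∀ v → InRange (f + nonroot t) (treesSize ts) v → δ v ≡ deg (attach (suc i) (f + nonroot t) ts) v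
  agreeRest v v∈ = trans (agree v (inRange-+ʳ v∈)) (deg-attach-rest t ts i+l≤f v∈)

-- C_{p+1} has the vertices 0, …, p, so m = suc p from here on.
cycleSum : ℕ → (Edge → ℕ) → ℕ
cycleSum p g = sumBelow p (λ i → g (i , suc i)) + g (p , 0)

AllCycleEdges : ℕ → (ℕ → ℕ → Set) → Set
AllCycleEdges p R = (∀ i → i < p → R i (suc i)) × R p 0

allCycleEdges-map : ∀ {p} {R S : ℕ → ℕ → Set} → (∀ {a b} → R a b → S a b) →
  AllCycleEdges p R → AllCycleEdges p S
allCycleEdges-map R⇒S (path , closing) = (λ i i<p → R⇒S (path i i<p)) , R⇒S closing

allCycleEdges-distinct : ∀ {p} {R : ℕ → ℕ → Set} → 1 ≤ p → (∀ {a b} → a ≢ b → R a b) →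
  AllCycleEdges p R
allCycleEdges-distinct 1≤p R-distinct = (λ i _ → R-distinct (<⇒≢ (n<1+n i))) , R-distinct (>⇒≢ 1≤p)

sum-cycleEdges : ∀ p (g : Edge → ℕ) → sum (map g (cycleEdges (suc p))) ≡ cycleSum p g
sum-cycleEdges p g = begin-equality
  sum (map g (cycleEdges (suc p)))
    ≡⟨ sum-map-++ g (map (λ i → (i , suc i)) (upTo p)) [ (p , 0) ] ⟩
  sum (map g (map (λ i → (i , suc i)) (upTo p))) + (g (p , 0) + 0)
    ≡⟨ cong₂ _+_ (cong sum (sym (map-∘ (upTo p)))) (+-identityʳ (g (p , 0))) ⟩
  sum (map (λ i → g (i , suc i)) (upTo p)) + g (p , 0)
    ≡⟨ cong (_+ g (p , 0)) (sum-map-upTo p (λ i → g (i , suc i))) ⟩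
  cycleSum p g ∎

cycleSum-cong : ∀ p {g h : Edge → ℕ} → AllCycleEdges p (λ a b → g (a , b) ≡ h (a , b)) →
  cycleSum p g ≡ cycleSum p h
cycleSum-cong p (path , closing) = cong₂ _+_ (sumBelow-cong p path) closing

cycleSum-mono : ∀ p {g h : Edge → ℕ} → AllCycleEdges p (λ a b → g (a , b) ≤ h (a , b)) →
  cycleSum p g ≤ cycleSum p h
cycleSum-mono p (path , closing) = +-mono-≤ (sumBelow-mono p path) closing

cycleSum-affine : ∀ p c k (h : Edge → ℕ) → cycleSum p (λ e → c + k * h e) ≡ suc p * c + k * cycleSum p h
cycleSum-affine p c k h = begin-equality
  sumBelow p (λ i → c + k * h (i , suc i)) + (c + k * h (p , 0))
    ≡⟨ cong (_+ (c + k * h (p , 0))) (sumBelow-affine p c k (λ i → h (i , suc i))) ⟩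
  p * c + k * sumBelow p (λ i → h (i , suc i)) + (c + k * h (p , 0))
    ≡⟨ regroup p c k (sumBelow p (λ i → h (i , suc i))) (h (p , 0)) ⟩
  suc p * c + k * cycleSum p h ∎
  where
  regroup : ∀ n c k s x → n * c + k * s + (c + k * x) ≡ suc n * c + k * (s + x)
  regroup = solve-∀

cycleSum-endpoints : ∀ p (x : ℕ → ℕ) →
  cycleSum p (λ { (a , b) → x a + x b }) ≡ sumBelow (suc p) x + sumBelow (suc p) x
cycleSum-endpoints p x = begin-equality
  sumBelow p (λ i → x i + x (suc i)) + (x p + x 0)
    ≡⟨ cong (_+ (x p + x 0)) (sumBelow-+ p x (x ∘ suc)) ⟩
  sumBelow p x + sumBelow p (x ∘ suc) + (x p + x 0)
    ≡⟨ interchange (sumBelow p x) (sumBelow p (x ∘ suc)) (x p) (x 0) ⟩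
  sumBelow (suc p) x + (sumBelow p (x ∘ suc) + x 0)
    ≡⟨ cong (sumBelow (suc p) x +_) (trans (+-comm _ (x 0)) (sym (sumBelow-suc p x))) ⟩
  sumBelow (suc p) x + sumBelow (suc p) x ∎

deg-cycleEdges : ∀ p v →
  deg (cycleEdges (suc p)) v ≡ sumBelow (suc p) (indicator v) + sumBelow (suc p) (indicator v)
deg-cycleEdges p v = trans (sum-cycleEdges p (inc v)) (cycleSum-endpoints p (indicator v))

deg-cycleEdges-≤ : ∀ p v → v ≤ p → deg (cycleEdges (suc p)) v ≡ 2
deg-cycleEdges-≤ p v v≤p = trans (deg-cycleEdges p v) (cong₂ _+_ once once)
  where once = sumBelow-indicator-< (suc p) v (s≤s v≤p)

deg-cycleEdges-> : ∀ p v → p < v → deg (cycleEdges (suc p)) v ≡ 0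
deg-cycleEdges-> p v p<v = trans (deg-cycleEdges p v) (cong₂ _+_ never never)
  where never = sumBelow-indicator-≥ (suc p) v p<v

cycleSum-weight-cong : ∀ p {δ δ' : ℕ → ℕ} → (∀ v → v ≤ p → δ v ≡ δ' v) →
  cycleSum p (weight δ) ≡ cycleSum p (weight δ')
cycleSum-weight-cong p {δ} {δ'} δ≡ = cycleSum-cong p {weight δ} {weight δ'}
  ( (λ i i<p → squareSum-cong (δ≡ i (<⇒≤ i<p)) (δ≡ (suc i) i<p))
  , squareSum-cong (δ≡ p ≤-refl) (δ≡ 0 z≤n))
  where squareSum-cong = cong₂ (λ x y → (x + y) ^ 2)

cycleSum-weight-mono : ∀ p {δ δ' : ℕ → ℕ} → (∀ v → δ v ≤ δ' v) →
  cycleSum p (weight δ) ≤ cycleSum p (weight δ')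
cycleSum-weight-mono p {δ} {δ'} δ≤ = cycleSum-mono p {weight δ} {weight δ'}
  ((λ i _ → squareSum-mono (δ≤ i) (δ≤ (suc i))) , squareSum-mono (δ≤ p) (δ≤ 0))
  where
  squareSum-mono : ∀ {a a' b b'} → a ≤ a' → b ≤ b' → (a + b) ^ 2 ≤ (a' + b') ^ 2
  squareSum-mono a≤ b≤ = ^-monoˡ-≤ 2 (+-mono-≤ a≤ b≤)

cycleDegree : List Tree → ℕ → ℕ
cycleDegree ts v = 2 + rootDegree (treeAt ts v)

HM-unicyclic : ∀ p (ts : Vec Tree (suc p)) →
  HM (unicyclic (suc p) ts) ≡ cycleSum p (weight (cycleDegree (toList ts))) + sum (map (treeHM 2) (toList ts))
HM-unicyclic p ts = begin-equality
  HM (C ++ A)                                     ≡⟨ HM≡weightSum (C ++ A) ⟩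
  weightSum (deg (C ++ A)) (C ++ A)               ≡⟨ weightSum-++ (deg (C ++ A)) C A ⟩
  weightSum (deg (C ++ A)) C + weightSum (deg (C ++ A)) A
    ≡⟨ cong₂ _+_ (trans (sum-cycleEdges p (weight (deg (C ++ A)))) (cycleSum-weight-cong p degOnCycle))
                 (weightSum-attach tl (deg (C ++ A)) (≤-reflexive len) roots agree) ⟩
  cycleSum p (weight (cycleDegree tl)) + sum (map (treeHM 2) tl) ∎
  where
  tl = toList ts
  C  = cycleEdges (suc p)
  A  = attach 0 (suc p) tl
  len : length tl ≡ suc p
  len = length-toList ts
  degOnCycle : ∀ v → v ≤ p → deg (C ++ A) v ≡ cycleDegree tl v
  degOnCycle v v≤p =
    trans (deg-++ C A v)
          (cong₂ _+_ (deg-cycleEdges-≤ p v v≤p)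
                     (deg-attach-root tl v (≤-reflexive len) (subst (v <_) (sym len) (s≤s v≤p))))
  roots : ∀ j → j < length tl → deg (C ++ A) j ≡ rootDegree (treeAt tl j) + 2
  roots j j<l = trans (degOnCycle j (≤-pred (subst (j <_) len j<l))) (+-comm 2 _)
  agree : ∀ v → InRange (suc p) (treesSize tl) v → deg (C ++ A) v ≡ deg A v
  agree v (p<v , _) = trans (deg-++ C A v) (cong (_+ deg A v) (deg-cycleEdges-> p v p<v))

-- A tree against the star with the same number of vertices

length≤nonroots : ∀ cs → length cs ≤ nonroots cs
length≤nonroots []       = z≤n
length≤nonroots (c ∷ cs) = s≤s (≤-trans (length≤nonroots cs) (m≤n+m (nonroots cs) (nonroot c)))

rootDegree≤nonroot : ∀ t → rootDegree t ≤ nonroot t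
rootDegree≤nonroot (node cs) = length≤nonroots cs

-- K bounds the degree sum of every edge below the root.
module ForestBudget (c : Tree) (cs : List Tree) (e K : ℕ) (budget : suc (nonroots (c ∷ cs)) + e ≤ K) where

  rootEdge-fits : suc (length cs) + e + suc (rootDegree c) ≤ K
  rootEdge-fits = begin
    suc (length cs) + e + suc (rootDegree c)   ≡⟨ regroup (length cs) (rootDegree c) e ⟩
    length cs + rootDegree c + suc (suc e)
      ≤⟨ +-monoˡ-≤ (suc (suc e)) (+-mono-≤ (length≤nonroots cs) (rootDegree≤nonroot c)) ⟩
    nonroots cs + nonroot c + suc (suc e)      ≡⟨ regroup′ (nonroots cs) (nonroot c) e ⟩
    suc (nonroots (c ∷ cs)) + e                ≤⟨ budget ⟩
    K                                          ∎
    where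
    regroup : ∀ l r e → suc l + e + suc r ≡ l + r + suc (suc e)
    regroup = solve-∀
    regroup′ : ∀ n m e → n + m + suc (suc e) ≡ suc (suc (m + n)) + e
    regroup′ = solve-∀

  subtree-fits : nonroot c + 2 + e ≤ K
  subtree-fits = begin
    nonroot c + 2 + e                       ≡⟨ cong (_+ e) (+-comm (nonroot c) 2) ⟩
    suc (suc (nonroot c)) + e               ≤⟨ +-monoˡ-≤ e (s≤s (s≤s (m≤m+n (nonroot c) (nonroots cs)))) ⟩
    suc (nonroots (c ∷ cs)) + e             ≤⟨ budget ⟩
    K                                       ∎

  rest-fits : suc (nonroots cs) + suc e ≤ K
  rest-fits = begin
    suc (nonroots cs) + suc e               ≡⟨ cong suc (+-suc (nonroots cs) e) ⟩
    suc (suc (nonroots cs)) + e             ≤⟨ +-monoˡ-≤ e (s≤s (s≤s (m≤n+m (nonroots cs) (nonroot c)))) ⟩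
    suc (nonroots (c ∷ cs)) + e             ≤⟨ budget ⟩
    K                                       ∎

forestHM-reindex : ∀ cs e → forestHM (suc (length cs) + e) cs ≡ forestHM (length cs + suc e) cs
forestHM-reindex cs e = cong (λ d → forestHM d cs) (sym (+-suc (length cs) e))

treeHM-bound   : ∀ e t → treeHM e t ≤ nonroot t * (nonroot t + suc e) ^ 2
forestHM-bound : ∀ cs e K → suc (nonroots cs) + e ≤ K → forestHM (length cs + e) cs ≤ nonroots cs * K ^ 2
forestHM-∷-parts : ∀ c cs e K → suc (nonroots (c ∷ cs)) + e ≤ K →
  (suc (length cs) + e + suc (rootDegree c)) ^ 2 ≤ K ^ 2
  × treeHM 1 c ≤ nonroot c * K ^ 2
  × forestHM (suc (length cs) + e) cs ≤ nonroots cs * K ^ 2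

treeHM-bound e (node cs) = forestHM-bound cs e (nonroots cs + suc e) (≤-reflexive (sym (+-suc (nonroots cs) e)))

forestHM-bound []       e K budget = z≤n
forestHM-bound (c ∷ cs) e K budget with forestHM-∷-parts c cs e K budget
... | rootEdge≤ , subtree≤ , rest≤ = begin
  (suc (length cs) + e + suc (rootDegree c)) ^ 2 + treeHM 1 c + forestHM (suc (length cs) + e) cs
    ≤⟨ +-mono-≤ (+-mono-≤ rootEdge≤ subtree≤) rest≤ ⟩
  K ^ 2 + nonroot c * K ^ 2 + nonroots cs * K ^ 2
    ≡⟨ sym (*-distribʳ-+ (K ^ 2) (suc (nonroot c)) (nonroots cs)) ⟩
  nonroots (c ∷ cs) * K ^ 2 ∎

forestHM-∷-parts c cs e K budget =
  ^-monoˡ-≤ 2 rootEdge-fits ,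
  ≤-trans (treeHM-bound 1 c) (*-monoʳ-≤ (nonroot c) (^-monoˡ-≤ 2 (≤-trans (m≤m+n _ e) subtree-fits))) ,
  subst (_≤ nonroots cs * K ^ 2) (sym (forestHM-reindex cs e)) (forestHM-bound cs (suc e) K rest-fits)
  where open ForestBudget c cs e K budget

subtreeHM-tight⇒leaf : ∀ c {K} → nonroot c + 2 < K → treeHM 1 c ≡ nonroot c * K ^ 2 → c ≡ leaf
subtreeHM-tight⇒leaf (node [])        fits tight = refl
subtreeHM-tight⇒leaf c@(node (_ ∷ _)) fits tight =
  ⊥-elim (<-irrefl tight (≤-<-trans (treeHM-bound 1 c) (*-monoʳ-< (nonroot c) (^-monoˡ-< 2 fits))))

forestHM-tight : ∀ cs e K → 1 ≤ e → suc (nonroots cs) + e ≤ K →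
  forestHM (length cs + e) cs ≡ nonroots cs * K ^ 2 → LAll.All (_≡ leaf) cs
forestHM-tight []       e K 1≤e budget tight = LAll.[]
forestHM-tight (c ∷ cs) e K 1≤e budget tight with forestHM-∷-parts c cs e K budget
... | rootEdge≤ , subtree≤ , rest≤
  with +-≤-tight (+-mono-≤ rootEdge≤ subtree≤) rest≤
                 (trans tight (*-distribʳ-+ (K ^ 2) (suc (nonroot c)) (nonroots cs)))
... | rootEdgeSubtree≡ , rest≡ =
  subtreeHM-tight⇒leaf c (<-≤-trans (m<m+n (nonroot c + 2) 1≤e) subtree-fits)
                  (proj₂ (+-≤-tight rootEdge≤ subtree≤ rootEdgeSubtree≡))
  LAll.∷ forestHM-tight cs (suc e) K (s≤s z≤n) rest-fits (trans (sym (forestHM-reindex cs e)) rest≡)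
  where open ForestBudget c cs e K budget

treeHM-tight : ∀ e t → 1 ≤ e → treeHM e t ≡ nonroot t * (nonroot t + suc e) ^ 2 → CenteredStar t
treeHM-tight e (node cs) 1≤e =
  forestHM-tight cs e (nonroots cs + suc e) 1≤e (≤-reflexive (sym (+-suc (nonroots cs) e)))

starWeight : ℕ → ℕ
starWeight l = l * (l + 3) ^ 2

nonroot-star : ∀ l → nonroot (star l) ≡ l
nonroot-star zero    = refl
nonroot-star (suc l) = cong suc (nonroot-star l)

rootDegree-star : ∀ l → rootDegree (star l) ≡ l
rootDegree-star l = length-replicate l

forestHM-leaves : ∀ l d → forestHM d (replicate l leaf) ≡ l * (d + 1) ^ 2
forestHM-leaves zero    d = refl
forestHM-leaves (suc l) d = cong₂ _+_ (+-identityʳ ((d + 1) ^ 2)) (forestHM-leaves l d)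

treeHM-star : ∀ l → treeHM 2 (star l) ≡ starWeight l
treeHM-star l =
  trans (forestHM-leaves l (length (replicate l leaf) + 2))
        (cong (λ n → l * n ^ 2) (trans (cong (λ n → n + 2 + 1) (length-replicate l)) (+-assoc l 2 1)))

star-of-centered : ∀ t → CenteredStar t → star (nonroot t) ≡ t
star-of-centered (node cs) leaves = cong node (go cs leaves)
  where
  go : ∀ cs → LAll.All (_≡ leaf) cs → replicate (nonroots cs) leaf ≡ cs
  go []       LAll.[]            = refl
  go (_ ∷ cs) (refl LAll.∷ rest) = cong (leaf ∷_) (go cs rest)

star-centered : ∀ l → CenteredStar (star l)
star-centered zero    = LAll.[]
star-centered (suc l) = refl LAll.∷ star-centered l

-- How the non-root vertices are spread over the trees

nontrivials : List Tree → ℕ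
nontrivials ts = length (filter (λ t → T? (isNontrivial t)) ts)

starsWeight : List Tree → ℕ
starsWeight ts = sum (map (starWeight ∘ nonroot) ts)

treesHM≤starsWeight : ∀ ts → sum (map (treeHM 2) ts) ≤ starsWeight ts
treesHM≤starsWeight []       = z≤n
treesHM≤starsWeight (t ∷ ts) = +-mono-≤ (treeHM-bound 2 t) (treesHM≤starsWeight ts)

treesHM-tight⇒centered : ∀ {k} (ts : Vec Tree k) →
  sum (map (treeHM 2) (toList ts)) ≡ starsWeight (toList ts) → All CenteredStar ts
treesHM-tight⇒centered Vec.[]       _     = VAll.[]
treesHM-tight⇒centered (t Vec.∷ ts) tight
  with +-≤-tight (treeHM-bound 2 t) (treesHM≤starsWeight (toList ts)) tight
... | t-tight , ts-tight = treeHM-tight 2 t (s≤s z≤n) t-tight VAll.∷ treesHM-tight⇒centered ts ts-tight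

starify-centered : ∀ {k} (ts : Vec Tree k) → All CenteredStar ts → starify ts ≡ ts
starify-centered Vec.[]       VAll.[]              = refl
starify-centered (t Vec.∷ ts) (centered VAll.∷ cs) =
  cong₂ Vec._∷_ (star-of-centered t centered) (starify-centered ts cs)

nontrivials≡0⇒treesSize≡0 : ∀ ts → nontrivials ts ≡ 0 → treesSize ts ≡ 0
nontrivials≡0⇒treesSize≡0 []       _ = refl
nontrivials≡0⇒treesSize≡0 (t ∷ ts) none with nonroot t
... | zero  = nontrivials≡0⇒treesSize≡0 ts none
... | suc _ with () ← none

treesSize≡0⇒nontrivials≡0 : ∀ ts → treesSize ts ≡ 0 → nontrivials ts ≡ 0
treesSize≡0⇒nontrivials≡0 []       _ = refl
treesSize≡0⇒nontrivials≡0 (t ∷ ts) empty with nonroot t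
... | zero  = treesSize≡0⇒nontrivials≡0 ts empty
... | suc _ with () ← empty

starWeight-superadditive : ∀ a b → starWeight a + starWeight b ≤ starWeight (a + b)
starWeight-superadditive a b = begin
  a * (a + 3) ^ 2 + b * (b + 3) ^ 2
    ≤⟨ +-mono-≤ (*-monoʳ-≤ a (^-monoˡ-≤ 2 (+-monoˡ-≤ 3 (m≤m+n a b))))
                (*-monoʳ-≤ b (^-monoˡ-≤ 2 (+-monoˡ-≤ 3 (m≤n+m b a)))) ⟩
  a * (a + b + 3) ^ 2 + b * (a + b + 3) ^ 2
    ≡⟨ sym (*-distribʳ-+ ((a + b + 3) ^ 2) a b) ⟩
  starWeight (a + b) ∎

starWeight-strictly-superadditive : ∀ a b → 0 < a → 0 < b → starWeight a + starWeight b < starWeight (a + b)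
starWeight-strictly-superadditive a@(suc _) b 0<a 0<b = begin-strict
  a * (a + 3) ^ 2 + b * (b + 3) ^ 2
    <⟨ +-mono-<-≤ (*-monoʳ-< a (^-monoˡ-< 2 (+-monoˡ-< 3 (m<m+n a 0<b))))
                  (*-monoʳ-≤ b (^-monoˡ-≤ 2 (+-monoˡ-≤ 3 (m≤n+m b a)))) ⟩
  a * (a + b + 3) ^ 2 + b * (a + b + 3) ^ 2
    ≡⟨ sym (*-distribʳ-+ ((a + b + 3) ^ 2) a b) ⟩
  starWeight (a + b) ∎

starsWeight≤starWeight : ∀ ts → starsWeight ts ≤ starWeight (treesSize ts)
starsWeight≤starWeight []       = z≤n
starsWeight≤starWeight (t ∷ ts) = ≤-trans (+-monoʳ-≤ (starWeight (nonroot t)) (starsWeight≤starWeight ts))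
                                (starWeight-superadditive (nonroot t) (treesSize ts))

starsWeight-tight⇒nontrivials≤1 : ∀ ts → starsWeight ts ≡ starWeight (treesSize ts) → nontrivials ts ≤ 1
starsWeight-tight⇒nontrivials≤1 []       _     = z≤n
starsWeight-tight⇒nontrivials≤1 (t ∷ ts) tight with nonroot t
... | zero = starsWeight-tight⇒nontrivials≤1 ts tight
... | a@(suc _) with treesSize ts in size
...   | zero  = s≤s (≤-reflexive (treesSize≡0⇒nontrivials≡0 ts size))
...   | b@(suc _) = ⊥-elim (<-irrefl tight (begin-strict
  starWeight a + starsWeight ts
    ≤⟨ +-monoʳ-≤ (starWeight a) (subst (λ n → starsWeight ts ≤ starWeight n) size (starsWeight≤starWeight ts)) ⟩
  starWeight a + starWeight b    <⟨ starWeight-strictly-superadditive a b z<s z<s ⟩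
  starWeight (a + b)             ∎))

treeAt-size≤ : ∀ ts i → nonroot (treeAt ts i) ≤ treesSize ts
treeAt-size≤ []       i       = z≤n
treeAt-size≤ (t ∷ ts) zero    = m≤m+n (nonroot t) (treesSize ts)
treeAt-size≤ (t ∷ ts) (suc i) = ≤-trans (treeAt-size≤ ts i) (m≤n+m (treesSize ts) (nonroot t))

treeAt-pair≤ : ∀ ts {i j} → i ≢ j → nonroot (treeAt ts i) + nonroot (treeAt ts j) ≤ treesSize ts
treeAt-pair≤ []       _ = z≤n
treeAt-pair≤ (t ∷ ts) {zero}  {zero}  i≢j = ⊥-elim (i≢j refl)
treeAt-pair≤ (t ∷ ts) {zero}  {suc j} _   = +-monoʳ-≤ (nonroot t) (treeAt-size≤ ts j)
treeAt-pair≤ (t ∷ ts) {suc i} {zero}  _   =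
  subst (_≤ treesSize (t ∷ ts)) (+-comm (nonroot t) _) (+-monoʳ-≤ (nonroot t) (treeAt-size≤ ts i))
treeAt-pair≤ (t ∷ ts) {suc i} {suc j} i≢j =
  ≤-trans (treeAt-pair≤ ts (i≢j ∘ cong suc)) (m≤n+m (treesSize ts) (nonroot t))

sumBelow-treeAt : ∀ ts → sumBelow (length ts) (nonroot ∘ treeAt ts) ≡ treesSize ts
sumBelow-treeAt []       = refl
sumBelow-treeAt (t ∷ ts) =
  trans (sumBelow-suc (length ts) (nonroot ∘ treeAt (t ∷ ts))) (cong (nonroot t +_) (sumBelow-treeAt ts))

treesSize≡0⇒starsWeight≡0 : ∀ ts → treesSize ts ≡ 0 → starsWeight ts ≡ 0
treesSize≡0⇒starsWeight≡0 ts empty =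
  n≤0⇒n≡0 (subst (λ n → starsWeight ts ≤ starWeight n) empty (starsWeight≤starWeight ts))

nontrivials≡1⇒starsWeight-tight : ∀ ts → nontrivials ts ≡ 1 → starsWeight ts ≡ starWeight (treesSize ts)
nontrivials≡1⇒starsWeight-tight (t ∷ ts) one with nonroot t
... | zero      = nontrivials≡1⇒starsWeight-tight ts one
... | a@(suc _) = begin-equality
  starWeight a + starsWeight ts   ≡⟨ cong (starWeight a +_) (treesSize≡0⇒starsWeight≡0 ts empty) ⟩
  starWeight a + 0                ≡⟨ +-identityʳ (starWeight a) ⟩
  starWeight a                    ≡⟨ cong starWeight (sym (trans (cong (a +_) empty) (+-identityʳ a))) ⟩
  starWeight (a + treesSize ts)   ∎
  where
  empty : treesSize ts ≡ 0
  empty = nontrivials≡0⇒treesSize≡0 ts (suc-injective one)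

nontrivials≡1⇒size∈ : ∀ ts → nontrivials ts ≡ 1 → ∀ i →
  nonroot (treeAt ts i) ≡ 0 ⊎ nonroot (treeAt ts i) ≡ treesSize ts
nontrivials≡1⇒size∈ (t ∷ ts) one i with nonroot t in size-t
nontrivials≡1⇒size∈ (t ∷ ts) one zero    | zero  = inj₁ size-t
nontrivials≡1⇒size∈ (t ∷ ts) one (suc i) | zero  = nontrivials≡1⇒size∈ ts one i
nontrivials≡1⇒size∈ (t ∷ ts) one zero    | suc k =
  inj₂ (trans size-t (sym (trans (cong (suc k +_) (nontrivials≡0⇒treesSize≡0 ts (suc-injective one)))
                                 (+-identityʳ (suc k)))))
nontrivials≡1⇒size∈ (t ∷ ts) one (suc i) | suc k =
  inj₁ (n≤0⇒n≡0 (subst (nonroot (treeAt ts i) ≤_) (nontrivials≡0⇒treesSize≡0 ts (suc-injective one))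
                       (treeAt-size≤ ts i)))

-- Starified and extremal graphs

squareSum-expand : ∀ a b → (2 + a + (2 + b)) ^ 2 ≡ 16 + (8 + (a + b)) * (a + b)
squareSum-expand = expand
  where
  expand : ∀ a b → (2 + a + (2 + b)) * ((2 + a + (2 + b)) * 1) ≡ 16 + (8 + (a + b)) * (a + b)
  expand = solve-∀

squareSum-bound : ∀ {a b} L → a + b ≤ L → (2 + a + (2 + b)) ^ 2 ≤ 16 + (8 + L) * (a + b)
squareSum-bound {a} {b} L s≤L = begin
  (2 + a + (2 + b)) ^ 2           ≡⟨ squareSum-expand a b ⟩
  16 + (8 + (a + b)) * (a + b)    ≤⟨ +-monoʳ-≤ 16 (*-monoˡ-≤ (a + b) (+-monoʳ-≤ 8 s≤L)) ⟩
  16 + (8 + L) * (a + b)          ∎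

squareSum-tight : ∀ {a b} L → a + b ≡ 0 ⊎ a + b ≡ L → (2 + a + (2 + b)) ^ 2 ≡ 16 + (8 + L) * (a + b)
squareSum-tight {a} {b} L s∈ = trans (squareSum-expand a b) (cong (16 +_) (extremes s∈))
  where
  extremes : a + b ≡ 0 ⊎ a + b ≡ L → (8 + (a + b)) * (a + b) ≡ (8 + L) * (a + b)
  extremes (inj₁ s≡0) = trans (vanish (8 + (a + b)) s≡0) (sym (vanish (8 + L) s≡0))
    where
    vanish : ∀ k {s} → s ≡ 0 → k * s ≡ 0
    vanish k refl = *-zeroʳ k
  extremes (inj₂ s≡L) = cong (λ n → (8 + n) * (a + b)) s≡L

pairSum-extreme : ∀ {a b L} → a + b ≤ L → a ≡ 0 ⊎ a ≡ L → b ≡ 0 ⊎ b ≡ L → a + b ≡ 0 ⊎ a + b ≡ L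
pairSum-extreme _    (inj₁ refl) b∈          = b∈
pairSum-extreme {L = L} _ (inj₂ refl) (inj₁ refl) = inj₂ (+-identityʳ L)
pairSum-extreme {L = L} L+L≤L (inj₂ refl) (inj₂ refl) = inj₂ (trans (cong (L +_) L≡0) (+-identityʳ L))
  where
  L≡0 : L ≡ 0
  L≡0 = n≤0⇒n≡0 (+-cancelˡ-≤ L L 0 (subst (L + L ≤_) (sym (+-identityʳ L)) L+L≤L))

starCycle-bound : ∀ p L (x : ℕ → ℕ) → AllCycleEdges p (λ a b → x a + x b ≤ L) →
  cycleSum p (weight (λ v → 2 + x v)) ≤ suc p * 16 + (8 + L) * (sumBelow (suc p) x + sumBelow (suc p) x)
starCycle-bound p L x fits = begin
  cycleSum p (weight (λ v → 2 + x v))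
    ≤⟨ cycleSum-mono p {weight (λ v → 2 + x v)} {λ e → 16 + (8 + L) * ends e}
                     (allCycleEdges-map (λ {a} {b} → squareSum-bound {x a} {x b} L) fits) ⟩
  cycleSum p (λ e → 16 + (8 + L) * ends e)  ≡⟨ cycleSum-affine p 16 (8 + L) ends ⟩
  suc p * 16 + (8 + L) * cycleSum p ends    ≡⟨ cong (λ n → suc p * 16 + (8 + L) * n) (cycleSum-endpoints p x) ⟩
  suc p * 16 + (8 + L) * (sumBelow (suc p) x + sumBelow (suc p) x) ∎
  where
  ends : Edge → ℕ
  ends (a , b) = x a + x b

starCycle-tight : ∀ p L (x : ℕ → ℕ) → AllCycleEdges p (λ a b → x a + x b ≡ 0 ⊎ x a + x b ≡ L) →
  cycleSum p (weight (λ v → 2 + x v)) ≡ suc p * 16 + (8 + L) * (sumBelow (suc p) x + sumBelow (suc p) x)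
starCycle-tight p L x extreme = begin-equality
  cycleSum p (weight (λ v → 2 + x v))
    ≡⟨ cycleSum-cong p {weight (λ v → 2 + x v)} {λ e → 16 + (8 + L) * ends e}
                     (allCycleEdges-map (λ {a} {b} → squareSum-tight {x a} {x b} L) extreme) ⟩
  cycleSum p (λ e → 16 + (8 + L) * ends e)  ≡⟨ cycleSum-affine p 16 (8 + L) ends ⟩
  suc p * 16 + (8 + L) * cycleSum p ends    ≡⟨ cong (λ n → suc p * 16 + (8 + L) * n) (cycleSum-endpoints p x) ⟩
  suc p * 16 + (8 + L) * (sumBelow (suc p) x + sumBelow (suc p) x) ∎
  where
  ends : Edge → ℕ
  ends (a , b) = x a + x b

starDegree : List Tree → ℕ → ℕ
starDegree ts v = 2 + nonroot (treeAt ts v)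

rootDegree-treeAt-starify : ∀ {k} (ts : Vec Tree k) v →
  rootDegree (treeAt (toList (starify ts)) v) ≡ nonroot (treeAt (toList ts) v)
rootDegree-treeAt-starify Vec.[]       v       = refl
rootDegree-treeAt-starify (t Vec.∷ ts) zero    = rootDegree-star (nonroot t)
rootDegree-treeAt-starify (t Vec.∷ ts) (suc v) = rootDegree-treeAt-starify ts v

treesHM-starify : ∀ {k} (ts : Vec Tree k) → sum (map (treeHM 2) (toList (starify ts))) ≡ starsWeight (toList ts)
treesHM-starify Vec.[]       = refl
treesHM-starify (t Vec.∷ ts) = cong₂ _+_ (treeHM-star (nonroot t)) (treesHM-starify ts)

HM-unicyclic-starify : ∀ p (ts : Vec Tree (suc p)) →
  HM (unicyclic (suc p) (starify ts)) ≡ cycleSum p (weight (starDegree (toList ts))) + starsWeight (toList ts)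
HM-unicyclic-starify p ts =
  trans (HM-unicyclic p (starify ts))
        (cong₂ _+_ (cycleSum-weight-cong p (λ v _ → cong (2 +_) (rootDegree-treeAt-starify ts v)))
                   (treesHM-starify ts))

extremalHM : ℕ → ℕ → ℕ
extremalHM p L = suc p * 16 + (8 + L) * (L + L) + starWeight L

module _ (p : ℕ) (ts : List Tree) (len : length ts ≡ suc p) (1≤p : 1 ≤ p) where

  private
    doubled : ℕ → ℕ
    doubled n = suc p * 16 + (8 + treesSize ts) * (n + n)

    sumBelow-sizes : sumBelow (suc p) (nonroot ∘ treeAt ts) ≡ treesSize ts
    sumBelow-sizes = subst (λ n → sumBelow n (nonroot ∘ treeAt ts) ≡ treesSize ts) len (sumBelow-treeAt ts)

  starCycleHM-bound :
    cycleSum p (weight (starDegree ts)) ≤ suc p * 16 + (8 + treesSize ts) * (treesSize ts + treesSize ts)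
  starCycleHM-bound =
    ≤-trans (starCycle-bound p (treesSize ts) (nonroot ∘ treeAt ts)
                             (allCycleEdges-distinct 1≤p (treeAt-pair≤ ts)))
            (≤-reflexive (cong doubled sumBelow-sizes))

  starifiedHM-bound : cycleSum p (weight (starDegree ts)) + starsWeight ts ≤ extremalHM p (treesSize ts)
  starifiedHM-bound = +-mono-≤ starCycleHM-bound (starsWeight≤starWeight ts)

  starifiedHM-extremal⇒nontrivials≤1 :
    cycleSum p (weight (starDegree ts)) + starsWeight ts ≡ extremalHM p (treesSize ts) → nontrivials ts ≤ 1
  starifiedHM-extremal⇒nontrivials≤1 extremal =
    starsWeight-tight⇒nontrivials≤1 ts (proj₂ (+-≤-tight starCycleHM-bound (starsWeight≤starWeight ts) extremal))

  nontrivials≡1⇒starifiedHM-extremal :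
    nontrivials ts ≡ 1 → cycleSum p (weight (starDegree ts)) + starsWeight ts ≡ extremalHM p (treesSize ts)
  nontrivials≡1⇒starifiedHM-extremal one =
    cong₂ _+_ (trans (starCycle-tight p (treesSize ts) (nonroot ∘ treeAt ts) (allCycleEdges-distinct 1≤p extreme))
                     (cong doubled sumBelow-sizes))
              (nontrivials≡1⇒starsWeight-tight ts one)
    where
    size∈ : ∀ i → nonroot (treeAt ts i) ≡ 0 ⊎ nonroot (treeAt ts i) ≡ treesSize ts
    size∈ = nontrivials≡1⇒size∈ ts one
    extreme : ∀ {a b} → a ≢ b → let s = nonroot (treeAt ts a) + nonroot (treeAt ts b) in s ≡ 0 ⊎ s ≡ treesSize ts
    extreme {a} {b} a≢b = pairSum-extreme (treeAt-pair≤ ts a≢b) (size∈ a) (size∈ b)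

module _ (p : ℕ) (ts : Vec Tree (suc p)) where

  private
    cycleHM≤ : cycleSum p (weight (cycleDegree (toList ts))) ≤ cycleSum p (weight (starDegree (toList ts)))
    cycleHM≤ = cycleSum-weight-mono p (λ v → +-monoʳ-≤ 2 (rootDegree≤nonroot (treeAt (toList ts) v)))

  HM-unicyclic≤starify : HM (unicyclic (suc p) ts) ≤ HM (unicyclic (suc p) (starify ts))
  HM-unicyclic≤starify =
    subst₂ _≤_ (sym (HM-unicyclic p ts)) (sym (HM-unicyclic-starify p ts))
           (+-mono-≤ cycleHM≤ (treesHM≤starsWeight (toList ts)))

  HM-unicyclic≡starify⇒centered :
    HM (unicyclic (suc p) ts) ≡ HM (unicyclic (suc p) (starify ts)) → All CenteredStar ts
  HM-unicyclic≡starify⇒centered equal =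
    treesHM-tight⇒centered ts
      (proj₂ (+-≤-tight cycleHM≤ (treesHM≤starsWeight (toList ts))
                        (trans (sym (HM-unicyclic p ts)) (trans equal (HM-unicyclic-starify p ts)))))

leaves-centered : ∀ p → All CenteredStar (Vec.replicate p leaf)
leaves-centered zero    = VAll.[]
leaves-centered (suc p) = LAll.[] VAll.∷ leaves-centered p

nontrivials-leaves : ∀ p → nontrivials (toList (Vec.replicate p leaf)) ≡ 0
nontrivials-leaves zero    = refl
nontrivials-leaves (suc p) = nontrivials-leaves p

HM-pendantsAt0 : ∀ p L → 1 ≤ p → 1 ≤ L → HM (unicyclic (suc p) (pendantsAt0 (suc p) L)) ≡ extremalHM p L
HM-pendantsAt0 p L@(suc k) 1≤p _ = begin-equality
  HM (unicyclic (suc p) P)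
    ≡⟨ cong (HM ∘ unicyclic (suc p)) (sym (starify-centered P centered)) ⟩
  HM (unicyclic (suc p) (starify P))
    ≡⟨ HM-unicyclic-starify p P ⟩
  cycleSum p (weight (starDegree (toList P))) + starsWeight (toList P)
    ≡⟨ nontrivials≡1⇒starifiedHM-extremal p (toList P) (length-toList P) 1≤p one ⟩
  extremalHM p (treesSize (toList P))
    ≡⟨ cong (extremalHM p) size ⟩
  extremalHM p L ∎
  where
  P = pendantsAt0 (suc p) L
  centered : All CenteredStar P
  centered = star-centered L VAll.∷ leaves-centered p
  one : nontrivials (toList P) ≡ 1
  one = cong suc (nontrivials-leaves p)
  size : treesSize (toList P) ≡ L
  size = trans (cong₂ _+_ (nonroot-star L)
                          (nontrivials≡0⇒treesSize≡0 (toList (Vec.replicate p leaf)) (nontrivials-leaves p)))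
               (+-identityʳ L)

corollary2p8 : (m : ℕ) → 3 ≤ m → (ts : Vec Tree m) → (n : ℕ) → n ≡ order m ts →
    1 ≤ numNontrivial ts →
    (HM (unicyclic m ts) ≤ HM (unicyclic m (starify ts)))
    × (HM (unicyclic m (starify ts)) ≤ HM (unicyclic m (pendantsAt0 m (n ∸ m))))
    × ((HM (unicyclic m ts) ≡ HM (unicyclic m (starify ts))) ⇔ All CenteredStar ts)
    × ((HM (unicyclic m (starify ts)) ≡ HM (unicyclic m (pendantsAt0 m (n ∸ m)))) ⇔ (numNontrivial ts ≡ 1))
corollary2p8 (suc p) (s≤s 1<p) ts _ refl atLeastOne rewrite m+n∸m≡n (suc p) (treesSize (toList ts)) =
    HM-unicyclic≤starify p ts
  , subst₂ _≤_ (sym starified) (sym extremal) (starifiedHM-bound p tl len 1≤p)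
  , mk⇔ (HM-unicyclic≡starify⇒centered p ts) (cong (HM ∘ unicyclic (suc p)) ∘ sym ∘ starify-centered ts)
  , mk⇔ (λ equal → ≤-antisym (starifiedHM-extremal⇒nontrivials≤1 p tl len 1≤p
                                 (trans (sym starified) (trans equal extremal)))
                             atLeastOne)
        (λ one → trans starified (trans (nontrivials≡1⇒starifiedHM-extremal p tl len 1≤p one) (sym extremal)))
  where
  tl = toList ts
  len : length tl ≡ suc p
  len = length-toList ts
  1≤p : 1 ≤ p
  1≤p = <⇒≤ 1<p
  nonempty : 1 ≤ treesSize tl
  nonempty = n≢0⇒n>0 (λ empty → <⇒≢ atLeastOne (sym (treesSize≡0⇒nontrivials≡0 tl empty)))
  starified : HM (unicyclic (suc p) (starify ts)) ≡ cycleSum p (weight (starDegree tl)) + starsWeight tl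
  starified = HM-unicyclic-starify p ts
  extremal : HM (unicyclic (suc p) (pendantsAt0 (suc p) (treesSize tl))) ≡ extremalHM p (treesSize tl)
  extremal = HM-pendantsAt0 p (treesSize tl) 1≤p nonempty
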